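{- Let $p$ be a prime and let $n=p^m-1$ for some nonnegative integer $m$. Then for all integers $k$ with $0\le k\le n-1$, the prime $p$ does not divide the Narayana number $N(n,k)=\frac{1}{n}\binom{n}{k}\binom{n}{k+1}$. -}

module Defs where

open import Data.Nat using (ℕ; zero; suc; _*_; _/_)
open import Data.Nat.Combinatorics using (_C_)

-- It is only meaningful for n ≥ 1 (where it is an integer); for n = 0 we
-- set it to 0 (never used in the statement, since 0 ≤ k ≤ n-1 forces n ≥ 1).
narayana : ℕ → ℕ → ℕ
narayana zero    k = 0
narayana (suc j) k = ((suc j C k) * (suc j C suc k)) / suc j

{-# OPTIONS --safe #-}
module Submission where

-- Write n + 1 = p ^ m. The absorption identity (k + 1) C(n + 1, k + 1) = p ^ m C(n, k)
-- shows that p divides C(n + 1, j) for 0 < j < p ^ m: otherwise p ^ m would divide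
-- k + 1 ≤ n. Pascal's rule C(n, k) + C(n, k + 1) = C(n + 1, k + 1) then carries
-- p ∤ C(n, 0) = 1 along the whole row: p ∤ C(n, k) for every k ≤ n. Finally
-- n N(n, k) = C(n, k) C(n, k + 1), because n divides both k C(n, k) and
-- (k + 1) C(n, k + 1), hence their difference; so p ∣ N(n, k) would make p divide one
-- of the two binomial coefficients.

open import Defs
open import Data.Nat using (ℕ; zero; suc; _^_; _∸_; _<_; _≤_; _+_; _*_; s≤s; nonTrivial⇒≢1)
open import Data.Nat.Combinatorics using (_C_; nC1≡n; nCk+nC[k+1]≡[n+1]C[k+1])
open import Data.Nat.DivMod using (m/n*n≡m)
open import Data.Nat.Divisibility
open import Data.Nat.Primality using (Prime; euclidsLemma; prime⇒nonZero; prime⇒nonTrivial)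
open import Data.Nat.Properties
open import Algebra.Properties.CommutativeSemigroup *-commutativeSemigroup using (x∙yz≈y∙xz)
open import Data.Sum using ([_,_]′)
open import Relation.Binary.PropositionalEquality
open import Relation.Nullary using (yes; no; contradiction)

[k+1]*[n+1]C[k+1]≡[n+1]*nCk : ∀ n k → suc k * (suc n C suc k) ≡ suc n * (n C k)
[k+1]*[n+1]C[k+1]≡[n+1]*nCk zero    zero    = refl
[k+1]*[n+1]C[k+1]≡[n+1]*nCk zero    (suc k) = *-zeroʳ (suc (suc k))
[k+1]*[n+1]C[k+1]≡[n+1]*nCk (suc n) zero    =
  trans (*-identityˡ _) (trans (nC1≡n (suc (suc n))) (sym (*-identityʳ (suc (suc n)))))
[k+1]*[n+1]C[k+1]≡[n+1]*nCk (suc n) (suc k) = begin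
  suc (suc k) * (suc (suc n) C suc (suc k))   ≡⟨ cong (suc (suc k) *_) (sym (pascal (suc n) (suc k))) ⟩
  suc (suc k) * (a + b)                       ≡⟨ *-distribˡ-+ (suc (suc k)) a b ⟩
  a + suc k * a + suc (suc k) * b             ≡⟨ cong₂ (λ u v → a + u + v) (absorb n k) (absorb n (suc k)) ⟩
  a + suc n * (n C k) + suc n * (n C suc k)   ≡⟨ +-assoc a _ _ ⟩
  a + (suc n * (n C k) + suc n * (n C suc k)) ≡⟨ cong (a +_) (sym (*-distribˡ-+ (suc n) (n C k) (n C suc k))) ⟩
  a + suc n * (n C k + n C suc k)             ≡⟨ cong (λ c → a + suc n * c) (pascal n k) ⟩
  suc (suc n) * a                             ∎
  where
  open ≡-Reasoning
  absorb = [k+1]*[n+1]C[k+1]≡[n+1]*nCk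
  pascal = nCk+nC[k+1]≡[n+1]C[k+1]
  a = suc n C suc k
  b = suc n C suc (suc k)

n∣k*nCk : ∀ n k → n ∣ k * (n C k)
n∣k*nCk n       zero    = n ∣0
n∣k*nCk zero    (suc k) = subst (0 ∣_) (sym (*-zeroʳ (suc k))) (0 ∣0)
n∣k*nCk (suc n) (suc k) = subst (suc n ∣_) (sym ([k+1]*[n+1]C[k+1]≡[n+1]*nCk n k)) (m∣m*n (n C k))

n∣nCk*nC[k+1] : ∀ n k → n ∣ (n C k) * (n C suc k)
n∣nCk*nC[k+1] n k = ∣m+n∣m⇒∣n (subst (n ∣_) (+-comm x (k * x)) n∣[1+k]*x) n∣k*x
  where
  x = (n C k) * (n C suc k)
  n∣k*x : n ∣ k * x
  n∣k*x = subst (n ∣_) (*-assoc k (n C k) (n C suc k)) (∣m⇒∣m*n (n C suc k) (n∣k*nCk n k))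
  n∣[1+k]*x : n ∣ suc k * x
  n∣[1+k]*x = subst (n ∣_) (x∙yz≈y∙xz (n C k) (suc k) (n C suc k)) (∣n⇒∣m*n (n C k) (n∣k*nCk n (suc k)))

narayana*n≡nCk*nC[k+1] : ∀ n k → narayana n k * n ≡ (n C k) * (n C suc k)
narayana*n≡nCk*nC[k+1] zero    k = sym (*-zeroʳ (0 C k))
narayana*n≡nCk*nC[k+1] (suc n) k = m/n*n≡m (n∣nCk*nC[k+1] (suc n) k)

p^i∣m*n⇒p^i∣m : ∀ {p m n} i → Prime p → p ∤ n → p ^ i ∣ m * n → p ^ i ∣ m
p^i∣m*n⇒p^i∣m zero _ _ _ = 1∣ _
p^i∣m*n⇒p^i∣m {p} {m} {n} (suc i) p-prime p∤n p^[1+i]∣m*n =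
  [ p∣m⇒p^[1+i]∣m , (λ p∣n → contradiction p∣n p∤n) ]′
    (euclidsLemma m n p-prime (m*n∣⇒m∣ p (p ^ i) p^[1+i]∣m*n))
  where
  instance _ = prime⇒nonZero p-prime
  p∣m⇒p^[1+i]∣m : p ∣ m → p ^ suc i ∣ m
  p∣m⇒p^[1+i]∣m (divides q refl) = subst (p ^ suc i ∣_) (*-comm p q) (*-monoʳ-∣ p p^i∣q)
    where
    p*p^i∣p*[q*n] : p * p ^ i ∣ p * (q * n)
    p*p^i∣p*[q*n] = subst (p ^ suc i ∣_) (trans (*-assoc q p n) (x∙yz≈y∙xz q p n)) p^[1+i]∣m*n
    p^i∣q : p ^ i ∣ q
    p^i∣q = p^i∣m*n⇒p^i∣m i p-prime p∤n (*-cancelˡ-∣ p p*p^i∣p*[q*n])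

module _ {p m n} (p-prime : Prime p) (p^m≡1+n : p ^ m ≡ suc n) where

  p∣[n+1]C[k+1] : ∀ {k} → k < n → p ∣ suc n C suc k
  p∣[n+1]C[k+1] {k} k<n with p ∣? (suc n C suc k)
  ... | yes p∣[n+1]C[k+1] = p∣[n+1]C[k+1]
  ... | no  p∤[n+1]C[k+1] = contradiction (∣⇒≤ p^m∣1+k) (<⇒≱ 1+k<p^m)
    where
    1+k<p^m : suc k < p ^ m
    1+k<p^m = subst (suc k <_) (sym p^m≡1+n) (s≤s k<n)
    p^m∣[k+1]*[n+1]C[k+1] : p ^ m ∣ suc k * (suc n C suc k)
    p^m∣[k+1]*[n+1]C[k+1] rewrite [k+1]*[n+1]C[k+1]≡[n+1]*nCk n k | p^m≡1+n = m∣m*n (n C k)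
    p^m∣1+k : p ^ m ∣ suc k
    p^m∣1+k = p^i∣m*n⇒p^i∣m m p-prime p∤[n+1]C[k+1] p^m∣[k+1]*[n+1]C[k+1]

  p∤nCk : ∀ {k} → k ≤ n → p ∤ n C k
  p∤nCk {zero}  _      p∣1 = contradiction (∣1⇒≡1 p∣1) (nonTrivial⇒≢1 {{prime⇒nonTrivial p-prime}})
  p∤nCk {suc k} 1+k≤n p∣nC[k+1] = p∤nCk (<⇒≤ 1+k≤n) p∣nCk
    where
    pascal : n C suc k + n C k ≡ suc n C suc k
    pascal = trans (+-comm (n C suc k) (n C k)) (nCk+nC[k+1]≡[n+1]C[k+1] n k)
    p∣nCk : p ∣ n C k
    p∣nCk = ∣m+n∣m⇒∣n (subst (p ∣_) (sym pascal) (p∣[n+1]C[k+1] 1+k≤n)) p∣nC[k+1]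

corollary2p1 : (p m : ℕ) → Prime p → (k : ℕ) → k < p ^ m ∸ 1 → p ∤ narayana (p ^ m ∸ 1) k
corollary2p1 p m p-prime k k<n with p ^ m in p^m≡1+n
corollary2p1 p m p-prime k () | zero
corollary2p1 p m p-prime k () | suc zero
... | suc (suc n) = λ p∣N →
  [ p∤[p^m∸1]Ck (<⇒≤ k<n) , p∤[p^m∸1]Ck k<n ]′ (euclidsLemma _ _ p-prime (p∣nCk*nC[k+1] p∣N))
  where
  p∤[p^m∸1]Ck : ∀ {k} → k ≤ suc n → p ∤ suc n C k
  p∤[p^m∸1]Ck = p∤nCk {m = m} p-prime p^m≡1+n
  p∣nCk*nC[k+1] : p ∣ narayana (suc n) k → p ∣ (suc n C k) * (suc n C suc k)
  p∣nCk*nC[k+1] p∣N = subst (p ∣_) (narayana*n≡nCk*nC[k+1] (suc n) k) (∣m⇒∣m*n (suc n) p∣N)
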